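{- Let $(X,\leq)$ be a poset and $C$ a closure operator on $X$. Then the lattice $F_{X/C}$ can be embedded into $F_X$ in such a way that all infima, all suprema, and the top and bottom elements are preserved under the embedding.
   Context: A closure operator on a poset $P$ is a map $C:P\to P$ with $p\leq C(p)$, $p\leq q\Rightarrow C(p)\leq C(q)$, $C(C(p))=C(p)$. $X/C$ is the set of equivalence classes of $x\sim' y\iff C(x)=C(y)$, ordered by $[x]\leq[y]$ iff $C(x)\leq C(y)$. For a poset $Y$, an up-set is a subset $U$ such that $x\in U$, $x\leq y$ imply $y\in U$; $\mathcal{F}_Y$ is the set of all up-sets of $Y$ and $F_Y=(\mathcal{F}_Y,\supseteq)$, a complete lattice whose meet is union and join is intersection. -}

module Defs where

open import Level using (Level; _⊔_; suc; Lift)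
open import Data.Empty using (⊥)
open import Data.Unit using (⊤)
open import Data.Product using (Σ; _×_; _,_; proj₁; proj₂)
open import Relation.Binary.Bundles using (Poset)
open import Relation.Binary.Structures using (IsPartialOrder; IsPreorder; IsEquivalence)

record IsClosureOperator {c ℓ₁ ℓ₂} (P : Poset c ℓ₁ ℓ₂)
                         (C : Poset.Carrier P → Poset.Carrier P) : Set (c ⊔ ℓ₁ ⊔ ℓ₂) where
  open Poset P
  field
    extensive  : ∀ p → p ≤ C p
    monotone   : ∀ {p q} → p ≤ q → C p ≤ C q
    idempotent : ∀ p → C (C p) ≈ C p

-- The quotient poset X/C.  Quotient types are unavailable, so X/C is
-- represented as a setoid-based poset: carrier X, equality x ~' y iff
-- C x ≈ C y, and order [x] ≤ [y] iff C x ≤ C y.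
_/_ : ∀ {c ℓ₁ ℓ₂} (X : Poset c ℓ₁ ℓ₂) → (Poset.Carrier X → Poset.Carrier X) → Poset c ℓ₁ ℓ₂
X / C = record
  { Carrier = Carrier
  ; _≈_ = λ x y → C x ≈ C y
  ; _≤_ = λ x y → C x ≤ C y
  ; isPartialOrder = record
    { isPreorder = record
      { isEquivalence = record
        { refl = Eq.refl ; sym = Eq.sym ; trans = Eq.trans }
      ; reflexive = reflexive
      ; trans = trans
      }
    ; antisym = antisym
    }
  }
  where open Poset X

record UpSet {c ℓ₁ ℓ₂} (Y : Poset c ℓ₁ ℓ₂) (p : Level) : Set (c ⊔ ℓ₂ ⊔ suc p) where
  constructor upset
  open Poset Y
  field
    mem  : Carrier → Set p
    up   : ∀ {x y} → mem x → x ≤ y → mem y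
open UpSet public

module _ {c ℓ₁ ℓ₂} {Y : Poset c ℓ₁ ℓ₂} {p : Level} where
  open Poset Y

  -- The order of F_Y is reverse inclusion ⊇.
  _⊇_ : UpSet Y p → UpSet Y p → Set (c ⊔ p)
  U ⊇ V = ∀ x → mem V x → mem U x

  _≐_ : UpSet Y p → UpSet Y p → Set (c ⊔ p)
  U ≐ V = (U ⊇ V) × (V ⊇ U)

  ⋀ : {I : Set p} → (I → UpSet Y p) → UpSet Y p
  ⋀ {I} F = upset (λ x → Σ I λ i → mem (F i) x)
                  (λ { (i , m) x≤y → i , up (F i) m x≤y })

  ⋁ : {I : Set p} → (I → UpSet Y p) → UpSet Y p
  ⋁ {I} F = upset (λ x → ∀ i → mem (F i) x) (λ m x≤y i → up (F i) (m i) x≤y)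

  ⊤F : UpSet Y p
  ⊤F = upset (λ _ → Lift p ⊥) (λ m _ → m)

  ⊥F : UpSet Y p
  ⊥F = upset (λ _ → Lift p ⊤) (λ m _ → m)

module Submission where

-- The embedding F_{X/C} → F_X is the preimage along the quotient map
-- q : X → X/C, x ↦ [x].
--
-- We first work with an arbitrary monotone map f : X → Y between posets.
-- The preimage f⁻¹(U) of an up-set U of Y is an up-set of X, and taking
-- preimages commutes with arbitrary unions and intersections and sends the
-- empty set and the whole of Y to the empty set and the whole of X; since
-- meets/joins/top/bottom of F are exactly unions/intersections/∅/everything,
-- the pullback preserves all of them.  If f is moreover surjective, then
-- f⁻¹(U) ⊇ f⁻¹(V) already forces U ⊇ V, so the pullback is an order
-- embedding.  Finally, the quotient map q is monotone because C is, and it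
-- is surjective (every class [y] is the image of y), so its pullback is the
-- required embedding.

open import Defs
open import Level using (Level)
open import Data.Product using (Σ; _×_; _,_)
open import Function using (_∘_; _⇔_; mk⇔)
open import Relation.Binary.Bundles using (Poset)

module Pullback {a aℓ₁ aℓ₂ b bℓ₁ bℓ₂} {X : Poset a aℓ₁ aℓ₂} {Y : Poset b bℓ₁ bℓ₂}
                (p : Level) (f : Poset.Carrier X → Poset.Carrier Y)
                (f-monotone : ∀ {x x′} → Poset._≤_ X x x′ → Poset._≤_ Y (f x) (f x′))
                where
  open Poset Y using (_≈_; reflexive)

  pullback : UpSet Y p → UpSet X p
  pullback U = upset (mem U ∘ f) (λ m x≤x′ → up U m (f-monotone x≤x′))

  pullback-mono : ∀ U V → U ⊇ V → pullback U ⊇ pullback V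
  pullback-mono U V U⊇V x = U⊇V (f x)

  mem-resp-≈ : ∀ (U : UpSet Y p) {y y′} → y ≈ y′ → mem U y → mem U y′
  mem-resp-≈ U y≈y′ m = up U m (reflexive y≈y′)

  pullback-reflects : (∀ y → Σ (Poset.Carrier X) λ x → f x ≈ y) →
                      ∀ U V → pullback U ⊇ pullback V → U ⊇ V
  pullback-reflects surj U V fU⊇fV y y∈V with surj y
  ... | x , fx≈y =
    mem-resp-≈ U fx≈y (fU⊇fV x (mem-resp-≈ V (Poset.Eq.sym Y fx≈y) y∈V))

  pullback-⋀ : ∀ {I : Set p} (F : I → UpSet Y p) → pullback (⋀ F) ≐ ⋀ (pullback ∘ F)
  pullback-⋀ F = (λ x m → m) , (λ x m → m)

  pullback-⋁ : ∀ {I : Set p} (F : I → UpSet Y p) → pullback (⋁ F) ≐ ⋁ (pullback ∘ F)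
  pullback-⋁ F = (λ x m → m) , (λ x m → m)

  pullback-⊤ : pullback ⊤F ≐ ⊤F
  pullback-⊤ = (λ x m → m) , (λ x m → m)

  pullback-⊥ : pullback ⊥F ≐ ⊥F
  pullback-⊥ = (λ x m → m) , (λ x m → m)

quotient-monotone : ∀ {c ℓ₁ ℓ₂} (X : Poset c ℓ₁ ℓ₂) (C : Poset.Carrier X → Poset.Carrier X) →
                    IsClosureOperator X C →
                    ∀ {x y} → Poset._≤_ X x y → Poset._≤_ (X / C) x y
quotient-monotone X C cl = IsClosureOperator.monotone cl

quotient-surjective : ∀ {c ℓ₁ ℓ₂} (X : Poset c ℓ₁ ℓ₂) (C : Poset.Carrier X → Poset.Carrier X) →
                      ∀ y → Σ (Poset.Carrier X) λ x → Poset._≈_ (X / C) x y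
quotient-surjective X C y = y , Poset.Eq.refl X

theorem6 : ∀ {c ℓ₁ ℓ₂} (p : Level) (X : Poset c ℓ₁ ℓ₂)
    (C : Poset.Carrier X → Poset.Carrier X) → IsClosureOperator X C →
    Σ (UpSet (X / C) p → UpSet X p) λ φ →
    (∀ U V → ((φ U ⊇ φ V) ⇔ (U ⊇ V)))
    × (∀ (I : Set p) (F : I → UpSet (X / C) p) → φ (⋀ F) ≐ ⋀ (φ ∘ F))
    × (∀ (I : Set p) (F : I → UpSet (X / C) p) → φ (⋁ F) ≐ ⋁ (φ ∘ F))
    × (φ ⊤F ≐ ⊤F)
    × (φ ⊥F ≐ ⊥F)
theorem6 p X C cl =
  pullback
  , (λ U V → mk⇔ (pullback-reflects (quotient-surjective X C) U V) (pullback-mono U V))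
  , (λ I → pullback-⋀)
  , (λ I → pullback-⋁)
  , pullback-⊤
  , pullback-⊥
  where open Pullback {X = X} {Y = X / C} p (λ x → x) (quotient-monotone X C cl)
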